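{- Let agents $N=[n]$ have matroid rank valuations over a finite set of goods $G$ and let $\pi:N\to[n]$ be a priority order. Let $i$ be the agent chosen to initiate a transfer path in some iteration of the Yankee Swap algorithm, let $W$ be the allocation at the beginning of that iteration, and let $|W_i|=k$. Then (1) every agent with higher priority than $i$ has a bundle of size at most $k+1$ in $W$, and (2) every agent with lower priority than $i$ has a bundle of size at most $k$ in $W$.
   Context: A valuation $v:2^G\to\mathbb{R}_{\ge 0}$ is a matroid rank valuation if $v(\emptyset)=0$, $v(S\cup\{g\})-v(S)\in\{0,1\}$ for all $S,g$, and $v$ is submodular. An allocation is a partition $X=(X_0,\dots,X_n)$ of $G$; $X_0$ (unallocated goods) is held by a dummy agent $0$ with $v_0(S)=|S|$. A transfer path from $i$ to $j$ in $X$ is a sequence of distinct goods $(g_1,\dots,g_k)$, $g_k\in X_j$, such that moving $g_k$ to the owner of $g_{k-1}$, ..., $g_2$ to the owner of $g_1$, and $g_1$ to $i$ increases $v_i$ by $1$, decreases $v_j$ by $1$, and leaves all other agents' values unchanged. Agents with smaller $\pi$ have higher priority. Yankee Swap: start with $X_0=G$, $X_i=\emptyset$, $P=N$; while $P\ne\emptyset$, let $i$ be the highest-priority agent among those in $P$ with minimum $|X_i|$ (this is the agent chosen in the iteration); if a transfer path from $i$ to $0$ exists, execute it, else remove $i$ from $P$. -}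

module Defs where

open import Data.Nat using (ℕ; suc; _+_; _≤_)
open import Data.Fin using (Fin; zero; suc; _≟_) renaming (_≤_ to _≤ᶠ_)
open import Data.Fin.Subset using (Subset; ⊤; ⊥; ⁅_⁆; _∈_; _∪_; _∩_; _-_; ∣_∣)
open import Data.Fin.Permutation using (Permutation′; _⟨$⟩ʳ_)
open import Data.Vec using (tabulate)
open import Data.List using (List; []; _∷_; _∷ʳ_)
open import Data.List.Relation.Unary.Unique.Propositional using (Unique)
open import Data.Product using (Σ; _×_; ∃)
open import Data.Sum using (_⊎_)
open import Data.Bool using (if_then_else_)
open import Relation.Nullary using (¬_; does)
open import Relation.Binary.PropositionalEquality using (_≡_; _≢_)

record MatroidRank {m : ℕ} (v : Subset m → ℕ) : Set where
  field
    empty      : v ⊥ ≡ 0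
    marginal   : ∀ S g → (v (S ∪ ⁅ g ⁆) ≡ v S) ⊎ (v (S ∪ ⁅ g ⁆) ≡ suc (v S))
    submodular : ∀ S T → v (S ∪ T) + v (S ∩ T) ≤ v S + v T

-- Allocation: each good is owned by an agent in Fin (suc n);
-- owner zero is the dummy agent 0 (unallocated goods),
-- owner (suc a) is real agent a (agents indexed by Fin n).
Alloc : ℕ → ℕ → Set
Alloc m n = Fin m → Fin (suc n)

bundle : ∀ {m n} → Alloc m n → Fin (suc n) → Subset m
bundle X a = tabulate (λ g → does (X g ≟ a))

valE : ∀ {m n} → (Fin n → Subset m → ℕ) → Fin (suc n) → Subset m → ℕ
valE v zero    = ∣_∣
valE v (suc a) = v a

-- Executing the path (g₁,…,g_k) towards agent i: g₁ goes to i,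
-- g_{t+1} goes to the (old) owner of g_t; other goods stay.
execute : ∀ {m n} → Alloc m n → Fin (suc n) → List (Fin m) → Alloc m n
execute {m} {n} X i gs g = go i gs
  where
  go : Fin (suc n) → List (Fin m) → Fin (suc n)
  go prev []       = X g
  go prev (h ∷ hs) = if does (g ≟ h) then prev else go (X h) hs

record TransferPath {m n} (v : Fin n → Subset m → ℕ) (X : Alloc m n)
                    (i j : Fin (suc n)) (gs : List (Fin m)) : Set where
  field
    distinct : Unique gs
    nonempty : Σ (List (Fin m)) λ hs → Σ (Fin m) λ gk → (gs ≡ hs ∷ʳ gk) × (X gk ≡ j)
    gain     : valE v i (bundle (execute X i gs) i) ≡ suc (valE v i (bundle X i))
    loss     : suc (valE v j (bundle (execute X i gs) j)) ≡ valE v j (bundle X j)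
    others   : ∀ a → a ≢ i → a ≢ j →
               valE v a (bundle (execute X i gs) a) ≡ valE v a (bundle X a)

size : ∀ {m n} → Alloc m n → Fin n → ℕ
size X a = ∣ bundle X (suc a) ∣

-- i is the agent chosen in the iteration with allocation X and active set P:
-- highest priority (smallest π) among agents of P with minimum bundle size.
record Chosen {m n} (π : Permutation′ n) (X : Alloc m n) (P : Subset n) (i : Fin n) : Set where
  field
    active   : i ∈ P
    minimal  : ∀ j → j ∈ P → size X i ≤ size X j
    priority : ∀ j → j ∈ P → size X j ≡ size X i → (π ⟨$⟩ʳ i) ≤ᶠ (π ⟨$⟩ʳ j)

-- States (W, P) reachable at the beginning of some iteration of Yankee Swap
-- (any transfer path may be executed when several exist).
data Reachable {m n} (v : Fin n → Subset m → ℕ) (π : Permutation′ n) :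
               Alloc m n → Subset n → Set where
  init     : Reachable v π (λ _ → zero) ⊤
  transfer : ∀ {X P i gs} → Reachable v π X P → Chosen π X P i →
             TransferPath v X (suc i) zero gs →
             Reachable v π (execute X (suc i) gs) P
  remove   : ∀ {X P i} → Reachable v π X P → Chosen π X P i →
             (∀ gs → ¬ TransferPath v X (suc i) zero gs) →
             Reachable v π X (P - i)

{-# OPTIONS --safe #-}
module Submission where

-- Only bundle sizes matter.
-- Executing a transfer path to the dummy agent hands each good on the path to the owner of its
-- predecessor (the first one to the initiator), so the initiator gains one good and no other
-- real agent's bundle size changes.
-- Along the run, every agent i still in P satisfies |W_j| ≤ |W_i| + 1 for all j, and
-- |W_j| ≤ |W_i| for every j of lower priority: the agent that gains a good had a bundle of
-- minimum size in P, strictly smaller than that of any agent of P with higher priority.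

open import Defs
open import Data.Nat using (ℕ; zero; suc; _+_; _≤_; s≤s; z≤n)
import Data.Nat.Properties as ℕ
open import Algebra.Properties.CommutativeSemigroup ℕ.+-commutativeSemigroup using (x∙yz≈y∙xz)
open import Data.Fin using (Fin; _<_; _≟_) renaming (zero to fzero; suc to fsuc; _≤_ to _≤ᶠ_)
import Data.Fin.Properties as Fin
open import Data.Fin.Subset using (Subset; ⊤; _∈_; _-_; ∣_∣)
open import Data.Fin.Subset.Properties using (p─q⊆p)
open import Data.Fin.Permutation using (Permutation′; _⟨$⟩ʳ_)
open import Data.Vec using (_∷_; tabulate)
import Data.Vec.Properties as Vec
open import Data.Vec.Functional using (updateAt)
open import Data.Vec.Functional.Properties using (updateAt-updates; updateAt-minimal)
open import Data.List using (List; []; _∷_; _∷ʳ_)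
open import Data.List.Relation.Unary.All as All using (All; []; _∷_)
open import Data.List.Relation.Unary.All.Properties using (∷ʳ⁻)
open import Data.List.Relation.Unary.AllPairs using (_∷_)
open import Data.List.Relation.Unary.Unique.Propositional using (Unique)
open import Data.Bool using (Bool; true; false; if_then_else_)
open import Data.Product using (_×_; _,_; proj₁; proj₂)
open import Data.Sum using (inj₁; inj₂)
open import Function using (const; _∘_)
open import Function.Bundles using (Injection)
open import Function.Properties.Inverse using (↔⇒↣)
open import Relation.Nullary using (does; yes; no; contradiction)
open import Relation.Nullary.Decidable using (dec-true; dec-false)
open import Relation.Binary.PropositionalEquality
  using (_≡_; _≢_; refl; sym; trans; cong; subst; subst₂; module ≡-Reasoning)

mutual
  -- The where-bound helper of execute is not in scope; this meta is solved to it by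
  -- unification with the unfolding of execute below.
  executeFrom : ∀ {m n} → Alloc m n → Fin (suc n) → List (Fin m) → Fin m →
                Fin (suc n) → List (Fin m) → Fin (suc n)
  executeFrom = _

  execute-unfold : ∀ {m n} (X : Alloc m n) i h hs g →
                   execute X i (h ∷ hs) g ≡
                   (if does (g ≟ h) then i else executeFrom X i (h ∷ hs) g (X h) hs)
  execute-unfold X i h hs g with h ∷ hs | X h
  ... | _ | _ = refl

executeFrom≡execute : ∀ {m n} (X : Alloc m n) i gs g p hs →
                      executeFrom X i gs g p hs ≡ execute X p hs g
executeFrom≡execute X i gs g p [] = refl
executeFrom≡execute X i gs g p (h ∷ hs) rewrite execute-unfold X p h hs g with does (g ≟ h)
... | true  = refl
... | false = trans (executeFrom≡execute X i gs g (X h) hs)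
                    (sym (executeFrom≡execute X p (h ∷ hs) g (X h) hs))

execute-∷ : ∀ {m n} (X : Alloc m n) i h hs g →
            execute X i (h ∷ hs) g ≡ (if does (g ≟ h) then i else execute X (X h) hs g)
execute-∷ X i h hs g =
  trans (execute-unfold X i h hs g)
        (cong (λ a → if does (g ≟ h) then i else a) (executeFrom≡execute X i (h ∷ hs) g (X h) hs))

execute-∉ : ∀ {m n} (X : Alloc m n) i hs g → All (g ≢_) hs → execute X i hs g ≡ X g
execute-∉ X i []       g []          = refl
execute-∉ X i (h ∷ hs) g (g≢h ∷ g∉hs) rewrite execute-∷ X i h hs g with g ≟ h
... | yes g≡h = contradiction g≡h g≢h
... | no  _   = execute-∉ X (X h) hs g g∉hs

execute-cong : ∀ {m n} (X Y : Alloc m n) i hs g →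
               All (λ h → X h ≡ Y h) hs → X g ≡ Y g → execute X i hs g ≡ execute Y i hs g
execute-cong X Y i []       g []              Xg≡Yg = Xg≡Yg
execute-cong X Y i (h ∷ hs) g (Xh≡Yh ∷ X≡Yhs) Xg≡Yg
  rewrite execute-∷ X i h hs g | execute-∷ Y i h hs g | Xh≡Yh with does (g ≟ h)
... | true  = refl
... | false = execute-cong X Y (Y h) hs g X≡Yhs Xg≡Yg

reassign : ∀ {m n} → Alloc m n → Fin m → Fin (suc n) → Alloc m n
reassign X h a = updateAt X h (const a)

execute-reassign : ∀ {m n} (X : Alloc m n) i h hs → All (h ≢_) hs → ∀ g →
                   execute X i (h ∷ hs) g ≡ execute (reassign X h i) (X h) hs g
execute-reassign X i h hs h∉hs g rewrite execute-∷ X i h hs g with g ≟ h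
... | yes refl = sym (trans (execute-∉ (reassign X g i) (X g) hs g h∉hs) (updateAt-updates g X))
... | no  g≢h  = execute-cong X (reassign X h i) (X h) hs g
                   (All.map (λ h≢h′ → sym (updateAt-minimal _ h X (h≢h′ ∘ sym))) h∉hs)
                   (sym (updateAt-minimal g h X g≢h))

indicator : Bool → ℕ
indicator b = if b then 1 else 0

∣b∷p∣ : ∀ {m} b (p : Subset m) → ∣ b ∷ p ∣ ≡ indicator b + ∣ p ∣
∣b∷p∣ true  p = refl
∣b∷p∣ false p = refl

∣tabulate∣-change : ∀ {m} (f f′ : Fin m → Bool) h → (∀ g → g ≢ h → f g ≡ f′ g) →
                    indicator (f h) + ∣ tabulate f′ ∣ ≡ indicator (f′ h) + ∣ tabulate f ∣
∣tabulate∣-change {suc m} f f′ fzero f≡f′ = begin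
  indicator (f fzero) + ∣ f′ fzero ∷ tabulate (f′ ∘ fsuc) ∣
    ≡⟨ cong (indicator (f fzero) +_) (∣b∷p∣ (f′ fzero) (tabulate (f′ ∘ fsuc))) ⟩
  indicator (f fzero) + (indicator (f′ fzero) + ∣ tabulate (f′ ∘ fsuc) ∣)
    ≡⟨ x∙yz≈y∙xz (indicator (f fzero)) (indicator (f′ fzero)) _ ⟩
  indicator (f′ fzero) + (indicator (f fzero) + ∣ tabulate (f′ ∘ fsuc) ∣)
    ≡⟨ cong (λ p → indicator (f′ fzero) + (indicator (f fzero) + ∣ p ∣))
            (Vec.tabulate-cong (λ g → sym (f≡f′ (fsuc g) λ ()))) ⟩
  indicator (f′ fzero) + (indicator (f fzero) + ∣ tabulate (f ∘ fsuc) ∣)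
    ≡⟨ cong (indicator (f′ fzero) +_) (∣b∷p∣ (f fzero) (tabulate (f ∘ fsuc))) ⟨
  indicator (f′ fzero) + ∣ tabulate f ∣ ∎
  where open ≡-Reasoning
∣tabulate∣-change {suc m} f f′ (fsuc h) f≡f′ = begin
  indicator (f (fsuc h)) + ∣ f′ fzero ∷ tabulate (f′ ∘ fsuc) ∣
    ≡⟨ cong (indicator (f (fsuc h)) +_) (∣b∷p∣ (f′ fzero) (tabulate (f′ ∘ fsuc))) ⟩
  indicator (f (fsuc h)) + (indicator (f′ fzero) + ∣ tabulate (f′ ∘ fsuc) ∣)
    ≡⟨ x∙yz≈y∙xz (indicator (f (fsuc h))) (indicator (f′ fzero)) _ ⟩
  indicator (f′ fzero) + (indicator (f (fsuc h)) + ∣ tabulate (f′ ∘ fsuc) ∣)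
    ≡⟨ cong (indicator (f′ fzero) +_)
            (∣tabulate∣-change (f ∘ fsuc) (f′ ∘ fsuc) h
                               (λ g g≢h → f≡f′ (fsuc g) (g≢h ∘ Fin.suc-injective))) ⟩
  indicator (f′ fzero) + (indicator (f′ (fsuc h)) + ∣ tabulate (f ∘ fsuc) ∣)
    ≡⟨ x∙yz≈y∙xz (indicator (f′ fzero)) (indicator (f′ (fsuc h))) _ ⟩
  indicator (f′ (fsuc h)) + (indicator (f′ fzero) + ∣ tabulate (f ∘ fsuc) ∣)
    ≡⟨ cong (λ b → indicator (f′ (fsuc h)) + (indicator b + ∣ tabulate (f ∘ fsuc) ∣))
            (f≡f′ fzero λ ()) ⟨
  indicator (f′ (fsuc h)) + (indicator (f fzero) + ∣ tabulate (f ∘ fsuc) ∣)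
    ≡⟨ cong (indicator (f′ (fsuc h)) +_) (∣b∷p∣ (f fzero) (tabulate (f ∘ fsuc))) ⟨
  indicator (f′ (fsuc h)) + ∣ tabulate f ∣ ∎
  where open ≡-Reasoning

∣tabulate-false∣ : ∀ m → ∣ tabulate {n = m} (const false) ∣ ≡ 0
∣tabulate-false∣ zero    = refl
∣tabulate-false∣ (suc m) = ∣tabulate-false∣ m

δ : ∀ {k} → Fin k → Fin k → ℕ
δ a b = indicator (does (a ≟ b))

bundle-cong : ∀ {m n} {X Y : Alloc m n} → (∀ g → X g ≡ Y g) → ∀ b → bundle X b ≡ bundle Y b
bundle-cong X≗Y b = Vec.tabulate-cong (λ g → cong (λ a → does (a ≟ b)) (X≗Y g))

∣bundle∣-reassign : ∀ {m n} (X : Alloc m n) h a b →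
                    δ (X h) b + ∣ bundle (reassign X h a) b ∣ ≡ δ a b + ∣ bundle X b ∣
∣bundle∣-reassign X h a b =
  subst (λ a′ → δ (X h) b + ∣ bundle (reassign X h a) b ∣ ≡ δ a′ b + ∣ bundle X b ∣)
        (updateAt-updates h X)
        (∣tabulate∣-change (λ g → does (X g ≟ b)) (λ g → does (reassign X h a g ≟ b)) h
                           (λ g g≢h → cong (λ a′ → does (a′ ≟ b)) (sym (updateAt-minimal g h X g≢h))))

∣bundle∣-execute : ∀ {m n} (X : Alloc m n) i hs gk → Unique (hs ∷ʳ gk) → ∀ b →
                   δ (X gk) b + ∣ bundle (execute X i (hs ∷ʳ gk)) b ∣ ≡ δ i b + ∣ bundle X b ∣
∣bundle∣-execute X i []       gk _ b =
  trans (cong (λ p → δ (X gk) b + ∣ p ∣) (bundle-cong (execute-reassign X i gk [] []) b))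
        (∣bundle∣-reassign X gk i b)
∣bundle∣-execute {m} {n} X i (h ∷ hs) gk (h∉hs∷gk ∷ unique) b = begin
  δ (X gk) b + ∣ bundle (execute X i (h ∷ hs ∷ʳ gk)) b ∣
    ≡⟨ cong (λ p → δ (X gk) b + ∣ p ∣) (bundle-cong (execute-reassign X i h (hs ∷ʳ gk) h∉hs∷gk) b) ⟩
  δ (X gk) b + ∣ bundle (execute X′ (X h) (hs ∷ʳ gk)) b ∣
    ≡⟨ cong (λ a → δ a b + ∣ bundle (execute X′ (X h) (hs ∷ʳ gk)) b ∣) X′gk≡Xgk ⟨
  δ (X′ gk) b + ∣ bundle (execute X′ (X h) (hs ∷ʳ gk)) b ∣
    ≡⟨ ∣bundle∣-execute X′ (X h) hs gk unique b ⟩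
  δ (X h) b + ∣ bundle X′ b ∣
    ≡⟨ ∣bundle∣-reassign X h i b ⟩
  δ i b + ∣ bundle X b ∣ ∎
  where
  open ≡-Reasoning
  X′ : Alloc m n
  X′ = reassign X h i
  X′gk≡Xgk : X′ gk ≡ X gk
  X′gk≡Xgk = updateAt-minimal gk h X (proj₂ (∷ʳ⁻ h∉hs∷gk) ∘ sym)

size-transfer : ∀ {m n} {v : Fin n → Subset m → ℕ} {X : Alloc m n} {c gs} →
                TransferPath v X (fsuc c) fzero gs → ∀ a →
                size (execute X (fsuc c) gs) a ≡ δ c a + size X a
size-transfer {X = X} {c} tp a with TransferPath.nonempty tp
... | hs , gk , refl , Xgk≡0 =
  subst (λ o → δ o (fsuc a) + size (execute X (fsuc c) (hs ∷ʳ gk)) a ≡ δ c a + size X a) Xgk≡0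
        (∣bundle∣-execute X (fsuc c) hs gk (TransferPath.distinct tp) (fsuc a))

module _ {m n : ℕ} (π : Permutation′ n) where

  Balanced : Alloc m n → Subset n → Set
  Balanced W P = ∀ {i} → i ∈ P → ∀ j →
                 size W j ≤ suc (size W i) × ((π ⟨$⟩ʳ i) ≤ᶠ (π ⟨$⟩ʳ j) → size W j ≤ size W i)

  chosen-< : ∀ {W : Alloc m n} {P c i} → Chosen π W P c → i ∈ P → c ≢ i →
             (π ⟨$⟩ʳ i) ≤ᶠ (π ⟨$⟩ʳ c) → suc (size W c) ≤ size W i
  chosen-< {c = c} {i} ch i∈P c≢i πi≤πc with ℕ.m≤n⇒m<n∨m≡n (Chosen.minimal ch i i∈P)
  ... | inj₁ c<i = c<i
  ... | inj₂ c≡i = contradiction (Injection.injective (↔⇒↣ π) πc≡πi) c≢i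
    where
    πc≡πi : π ⟨$⟩ʳ c ≡ π ⟨$⟩ʳ i
    πc≡πi = Fin.≤-antisym (Chosen.priority ch i i∈P (sym c≡i)) πi≤πc

  balanced-init : Balanced (λ _ → fzero) ⊤
  balanced-init _ j rewrite ∣tabulate-false∣ m = z≤n , λ _ → z≤n

  balanced-remove : ∀ {W P c} → Balanced W P → Balanced W (P - c)
  balanced-remove {P = P} balanced i∈P-c = balanced (p─q⊆p P _ i∈P-c)

  balanced-increment : ∀ {W W′ P c} → Balanced W P → Chosen π W P c →
                       (∀ a → size W′ a ≡ δ c a + size W a) → Balanced W′ P
  balanced-increment {W} {W′} {P} {c} balanced ch W′≡W+c {i} i∈P j = behind , lowerPriority
    where
    grows : ∀ a → size W a ≤ size W′ a
    grows a = subst (size W a ≤_) (sym (W′≡W+c a)) (ℕ.m≤n+m (size W a) _)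

    W′c≡1+Wc : size W′ c ≡ suc (size W c)
    W′c≡1+Wc = trans (W′≡W+c c) (cong (λ b → indicator b + size W c) (dec-true (c ≟ c) refl))

    W′≡W : ∀ {a} → c ≢ a → size W′ a ≡ size W a
    W′≡W {a} c≢a = trans (W′≡W+c a) (cong (λ b → indicator b + size W a) (dec-false (c ≟ a) c≢a))

    behind : size W′ j ≤ suc (size W′ i)
    behind with c ≟ j
    ... | yes refl = subst (_≤ suc (size W′ i)) (sym W′c≡1+Wc)
                           (s≤s (ℕ.≤-trans (Chosen.minimal ch i i∈P) (grows i)))
    ... | no  c≢j  = subst (_≤ suc (size W′ i)) (sym (W′≡W c≢j))
                           (ℕ.≤-trans (proj₁ (balanced i∈P j)) (s≤s (grows i)))

    lowerPriority : (π ⟨$⟩ʳ i) ≤ᶠ (π ⟨$⟩ʳ j) → size W′ j ≤ size W′ i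
    lowerPriority πi≤πj with c ≟ j
    ... | no  c≢j  = subst (_≤ size W′ i) (sym (W′≡W c≢j))
                           (ℕ.≤-trans (proj₂ (balanced i∈P j) πi≤πj) (grows i))
    ... | yes refl with c ≟ i
    ...   | yes refl = ℕ.≤-refl
    ...   | no  c≢i  = subst₂ _≤_ (sym W′c≡1+Wc) (sym (W′≡W c≢i)) (chosen-< ch i∈P c≢i πi≤πj)

  reachable⇒balanced : ∀ {v W P} → Reachable v π W P → Balanced W P
  reachable⇒balanced init = balanced-init
  reachable⇒balanced (transfer {X = X} {i = c} {gs} reach ch tp) =
    balanced-increment {W′ = execute X (fsuc c) gs} (reachable⇒balanced reach) ch (size-transfer tp)
  reachable⇒balanced (remove {X = W} {i = c} reach _ _) =
    balanced-remove {W = W} {c = c} (reachable⇒balanced reach)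

lemma4 : ∀ {m n} (v : Fin n → Subset m → ℕ) → (∀ a → MatroidRank (v a)) →
         (π : Permutation′ n) → (W : Alloc m n) (P : Subset n) (i : Fin n) (k : ℕ) →
         Reachable v π W P → Chosen π W P i → size W i ≡ k →
         (∀ j → (π ⟨$⟩ʳ j) < (π ⟨$⟩ʳ i) → size W j ≤ suc k) ×
         (∀ j → (π ⟨$⟩ʳ i) < (π ⟨$⟩ʳ j) → size W j ≤ k)
lemma4 v _ π W P i k reach ch refl =
  (λ j _ → proj₁ (balanced j)) , (λ j πi<πj → proj₂ (balanced j) (ℕ.<⇒≤ πi<πj))
  where
  balanced : ∀ j → size W j ≤ suc (size W i) × ((π ⟨$⟩ʳ i) ≤ᶠ (π ⟨$⟩ʳ j) → size W j ≤ size W i)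
  balanced = reachable⇒balanced π reach (Chosen.active ch)
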